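{- For all integers $c\ge1$ and $n\ge0$, $$I_{c,n}=\frac{c^n n!}{2}\left(c\binom{n+1}{2}-n\right).$$
   Context: For integers $n\ge0$, $c\ge1$, let $G_{c,n}$ be the set of colored permutations: words $\sigma=\sigma_1^{[c_1]}\cdots\sigma_n^{[c_n]}$ where $|\sigma|=\sigma_1\cdots\sigma_n$ is a permutation of $[n]$ and each color $c_i\in\{0,\dots,c-1\}$ (for $n=0$, $G_{c,0}$ consists of the empty word). For a permutation $\pi$ of $[n]$, $\mathrm{inv}(\pi)=|\{(i,j):i<j,\ \pi_i>\pi_j\}|$. Let $\mathrm{col}(\sigma)=c_1+\cdots+c_n$ and $\mathrm{inv}_c(\sigma)=\mathrm{inv}(|\sigma|)+\mathrm{col}(\sigma)+c\cdot|\{(i,j):1\le i<j\le n,\ \sigma_i<\sigma_j,\ c_j\ne0\}|$. Let $I_{c,n}=\sum_{\sigma\in G_{c,n}}\mathrm{inv}_c(\sigma)$. -}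

module Defs where

open import Data.Nat using (ℕ; zero; suc; _+_; _*_; _<ᵇ_)
open import Data.Bool using (Bool; true; false; _∧_; not; if_then_else_)
open import Data.Fin using (Fin; toℕ)
open import Data.Fin.Properties using (_≟_)
open import Data.List using (List; []; _∷_; map; concatMap; filter; allFin; zip)
open import Data.Nat.ListAction using (sum)
open import Data.Vec using (Vec; []; _∷_; toList)
open import Data.Product using (_×_; _,_; proj₁; proj₂)
open import Relation.Nullary.Decidable using (does)

allWords : (k n : ℕ) → List (Vec (Fin k) n)
allWords k zero = [] ∷ []
allWords k (suc n) = concatMap (λ a → map (a ∷_) (allWords k n)) (allFin k)

distinct : {m : ℕ} → List (Fin m) → Bool
distinct [] = true
distinct (x ∷ xs) = not (anyEq x xs) ∧ distinct xs
  where
  anyEq : {m : ℕ} → Fin m → List (Fin m) → Bool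
  anyEq x [] = false
  anyEq x (y ∷ ys) = does (x ≟ y) Data.Bool.∨ anyEq x ys

-- Permutations of [n], written in one-line notation with values in Fin n
-- (value i ∈ Fin n stands for i+1 ∈ [n]); a word of length n over [n] is a
-- permutation iff its letters are pairwise distinct.
perms : (n : ℕ) → List (Vec (Fin n) n)
perms n = filter (λ w → distinct (toList w) Data.Bool.≟ true) (allWords n n)
  where import Data.Bool

-- A colored permutation in G_{c,n}: underlying permutation |σ| and color vector (c_1,…,c_n).
ColPerm : (c n : ℕ) → Set
ColPerm c n = Vec (Fin n) n × Vec (Fin c) n

G : (c n : ℕ) → List (ColPerm c n)
G c n = concatMap (λ p → map (λ col → p , col) (allWords c n)) (perms n)

pairSum : {A : Set} → (A → A → ℕ) → List A → ℕ
pairSum f [] = 0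
pairSum f (x ∷ xs) = sum (map (f x) xs) + pairSum f xs

ind : Bool → ℕ
ind b = if b then 1 else 0

inv : {n : ℕ} → Vec (Fin n) n → ℕ
inv w = pairSum (λ a b → ind (toℕ b <ᵇ toℕ a)) (toList w)

col : {c n : ℕ} → ColPerm c n → ℕ
col (w , cs) = sum (map toℕ (toList cs))

ascNZ : {c n : ℕ} → ColPerm c n → ℕ
ascNZ (w , cs) =
  pairSum (λ a b → ind ((toℕ (proj₁ a) <ᵇ toℕ (proj₁ b)) ∧ (0 <ᵇ toℕ (proj₂ b))))
          (zip (toList w) (toList cs))

invc : (c : ℕ) {n : ℕ} → ColPerm c n → ℕ
invc c σ = inv (proj₁ σ) + col σ + c * ascNZ σ

I : (c n : ℕ) → ℕ
I c n = sum (map (invc c) (G c n))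

open import Relation.Binary.PropositionalEquality using (_≡_; refl)
private
  t1 : I 2 2 ≡ 16
  t1 = refl
  t2 : I 3 3 ≡ 1215
  t2 = refl

-- Fix a permutation π and sum inv_c over its c^n colourings: inv π is counted c^n times, each
-- position takes each colour in c^(n-1) colourings, so col contributes n c^(n-1) (0 + 1 + ⋯ + (c-1)),
-- and each pair i < j with π_i < π_j is counted by the (c-1) c^(n-1) colourings with c_j ≠ 0. Hence
--   c · Σ_colourings inv_c = c^n (c · inv π + n c (c-1)/2 + c (c-1) · asc π).
-- Summing over permutations, complementing the values (π_i ↦ n+1-π_i) exchanges inversions and
-- ascents, while inv π + asc π = binom(n,2); so Σ inv = Σ asc = n! binom(n,2)/2. Permutations are
-- the words of length n over [n] with distinct letters, and there are n! of them since a distinct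
-- word of length m over [k] extends to one of length m+1 in exactly k - m ways. Multiplying through
-- by 2c keeps the computation in ℕ.

{-# OPTIONS --safe #-}
module Submission where

open import Defs
open import Data.Bool as Bool using (Bool; true; false; T; not; _∧_; _∨_)
open import Data.Bool.Properties using (T-∧; T-not-≡; ∨-conicalˡ; ∨-conicalʳ)
open import Data.Empty using (⊥-elim)
open import Data.Fin using (Fin; toℕ; opposite)
open import Data.Fin.Properties using (_≟_; toℕ-injective; toℕ<n; opposite-prop; opposite-involutive)
open import Data.List using (List; []; _∷_; map; concatMap; filter; allFin; length; _++_; zip)
open import Data.List.Properties using (map-tabulate; length-tabulate)
open import Data.Nat using (ℕ; zero; suc; _+_; _*_; _∸_; _^_; _≤_; _!; _<ᵇ_; s<s; s<s⁻¹)
open import Data.Nat.Combinatorics using (_C_; nC1≡n; nCk+nC[k+1]≡[n+1]C[k+1])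
open import Data.Nat.ListAction using (sum)
open import Data.Nat.Properties
  using ( +-assoc; +-comm; +-identityʳ; +-suc; +-cancelʳ-≡; *-assoc; *-comm; *-identityʳ; *-zeroʳ
        ; *-distribˡ-+; *-distribʳ-+; *-cancelˡ-≡; m+n∸m≡n; ∸-cancelʳ-<; ∸-monoʳ-<; _<?_
        ; +-commutativeSemigroup; *-commutativeSemigroup )
open import Data.Nat.Tactic.RingSolver using (solve-∀)
open import Algebra.Properties.CommutativeSemigroup +-commutativeSemigroup using (interchange)
open import Algebra.Properties.CommutativeSemigroup *-commutativeSemigroup using ()
  renaming (x∙yz≈y∙xz to *-left-comm)
open import Data.Product using (Σ; _×_; _,_; proj₁; proj₂)
open import Data.Vec as Vec using (Vec; toList) renaming ([] to []ᵥ; _∷_ to _∷ᵥ_)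
open import Data.Vec.Properties using (length-toList; toList-map)
open import Function using (_∘_)
open import Function.Bundles using (mk⇔; Equivalence)
open import Function.Definitions using (Injective)
open import Relation.Nullary using (Dec; does; yes; no)
open import Relation.Nullary.Decidable using (does-⇔; dec-true)
open import Relation.Binary.PropositionalEquality
open ≡-Reasoning

private
  variable
    A B : Set

-- Finite sums

∑ : List A → (A → ℕ) → ℕ
∑ xs f = sum (map f xs)

infixr 5 ∑
syntax ∑ xs (λ x → e) = ∑[ x ← xs ] e

∑-cong : (xs : List A) {f g : A → ℕ} → (∀ x → f x ≡ g x) → ∑ xs f ≡ ∑ xs g
∑-cong []       eq = refl
∑-cong (x ∷ xs) eq = cong₂ _+_ (eq x) (∑-cong xs eq)

∑-++ : (xs ys : List A) (f : A → ℕ) → ∑ (xs ++ ys) f ≡ ∑ xs f + ∑ ys f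
∑-++ []       ys f = refl
∑-++ (x ∷ xs) ys f = trans (cong (f x +_) (∑-++ xs ys f)) (sym (+-assoc (f x) _ _))

∑-map : (g : A → B) (xs : List A) (f : B → ℕ) → ∑ (map g xs) f ≡ ∑[ x ← xs ] f (g x)
∑-map g []       f = refl
∑-map g (x ∷ xs) f = cong (f (g x) +_) (∑-map g xs f)

∑-concatMap : (g : A → List B) (xs : List A) (f : B → ℕ) →
              ∑ (concatMap g xs) f ≡ ∑[ x ← xs ] ∑ (g x) f
∑-concatMap g []       f = refl
∑-concatMap g (x ∷ xs) f = trans (∑-++ (g x) _ f) (cong (∑ (g x) f +_) (∑-concatMap g xs f))

∑-distrib-+ : (xs : List A) (f g : A → ℕ) → ∑[ x ← xs ] (f x + g x) ≡ ∑ xs f + ∑ xs g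
∑-distrib-+ []       f g = refl
∑-distrib-+ (x ∷ xs) f g = begin
  f x + g x + (∑[ y ← xs ] f y + g y) ≡⟨ cong (f x + g x +_) (∑-distrib-+ xs f g) ⟩
  f x + g x + (∑ xs f + ∑ xs g)       ≡⟨ interchange (f x) (g x) _ _ ⟩
  f x + ∑ xs f + (g x + ∑ xs g)       ∎

*-distribˡ-∑ : (k : ℕ) (xs : List A) (f : A → ℕ) → k * ∑ xs f ≡ ∑[ x ← xs ] k * f x
*-distribˡ-∑ k []       f = *-zeroʳ k
*-distribˡ-∑ k (x ∷ xs) f = trans (*-distribˡ-+ k (f x) _) (cong (k * f x +_) (*-distribˡ-∑ k xs f))

*-distribʳ-∑ : (k : ℕ) (xs : List A) (f : A → ℕ) → ∑ xs f * k ≡ ∑[ x ← xs ] f x * k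
*-distribʳ-∑ k xs f =
  trans (*-comm _ k) (trans (*-distribˡ-∑ k xs f) (∑-cong xs (λ x → *-comm k (f x))))

*-∑-cong : (k l : ℕ) (xs : List A) {f g : A → ℕ} →
           (∀ x → k * f x ≡ l * g x) → k * ∑ xs f ≡ l * ∑ xs g
*-∑-cong k l xs {f} {g} eq =
  trans (*-distribˡ-∑ k xs f) (trans (∑-cong xs eq) (sym (*-distribˡ-∑ l xs g)))

∑-const : (xs : List A) (k : ℕ) → ∑[ x ← xs ] k ≡ length xs * k
∑-const []       k = refl
∑-const (x ∷ xs) k = cong (k +_) (∑-const xs k)

∑-comm : (xs : List A) (ys : List B) (f : A → B → ℕ) →
         ∑[ x ← xs ] ∑[ y ← ys ] f x y ≡ ∑[ y ← ys ] ∑[ x ← xs ] f x y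
∑-comm []       ys f = sym (trans (∑-const ys 0) (*-zeroʳ (length ys)))
∑-comm (x ∷ xs) ys f = begin
  ∑ ys (f x) + (∑[ x′ ← xs ] ∑[ y ← ys ] f x′ y) ≡⟨ cong (∑ ys (f x) +_) (∑-comm xs ys f) ⟩
  ∑ ys (f x) + (∑[ y ← ys ] ∑[ x′ ← xs ] f x′ y) ≡⟨ ∑-distrib-+ ys (f x) _ ⟨
  ∑[ y ← ys ] f x y + (∑[ x′ ← xs ] f x′ y)      ∎

∑-filter : {P : A → Set} (P? : ∀ x → Dec (P x)) (xs : List A) (f : A → ℕ) →
           ∑ (filter P? xs) f ≡ ∑[ x ← xs ] ind (does (P? x)) * f x
∑-filter P? []       f = refl
∑-filter P? (x ∷ xs) f with does (P? x)
... | false = ∑-filter P? xs f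
... | true  = cong₂ _+_ (sym (+-identityʳ (f x))) (∑-filter P? xs f)

∑-zip-proj₂ : {m : ℕ} (xs : Vec A m) (ys : Vec B m) (g : B → ℕ) →
              ∑[ p ← zip (toList xs) (toList ys) ] g (proj₂ p) ≡ ∑ (toList ys) g
∑-zip-proj₂ []ᵥ        []ᵥ        g = refl
∑-zip-proj₂ (x ∷ᵥ xs) (y ∷ᵥ ys) g = cong (g y +_) (∑-zip-proj₂ xs ys g)

∑-allFin-suc : (k : ℕ) (f : Fin (suc k) → ℕ) →
               ∑ (allFin (suc k)) f ≡ f Fin.zero + (∑[ i ← allFin k ] f (Fin.suc i))
∑-allFin-suc k f = cong (λ xs → f Fin.zero + sum xs)
  (trans (map-tabulate Fin.suc f) (sym (map-tabulate (λ i → i) (f ∘ Fin.suc))))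

∑-allFin-const : (k x : ℕ) → ∑[ i ← allFin k ] x ≡ k * x
∑-allFin-const k x = trans (∑-const (allFin k) x) (cong (_* x) (length-tabulate {n = k} (λ i → i)))

2*∑-allFin-toℕ : (d : ℕ) → 2 * ∑ (allFin (suc d)) toℕ ≡ suc d * d
2*∑-allFin-toℕ zero    = refl
2*∑-allFin-toℕ (suc d) = begin
  2 * ∑ (allFin (suc (suc d))) toℕ       ≡⟨ cong (2 *_) shift ⟩
  2 * (suc d * 1 + S)                   ≡⟨ *-distribˡ-+ 2 (suc d * 1) S ⟩
  2 * (suc d * 1) + 2 * S               ≡⟨ cong (2 * (suc d * 1) +_) (2*∑-allFin-toℕ d) ⟩
  2 * (suc d * 1) + suc d * d           ≡⟨ gauss-step d ⟩
  suc (suc d) * suc d                   ∎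
  where
  S = ∑ (allFin (suc d)) toℕ
  shift : ∑ (allFin (suc (suc d))) toℕ ≡ suc d * 1 + S
  shift = trans (∑-allFin-suc (suc d) toℕ)
                (trans (∑-distrib-+ (allFin (suc d)) (λ _ → 1) toℕ) (cong (_+ S) (∑-allFin-const (suc d) 1)))
  gauss-step : ∀ d → 2 * (suc d * 1) + suc d * d ≡ suc (suc d) * suc d
  gauss-step = solve-∀

∑-allWords-suc : (k m : ℕ) (f : Vec (Fin k) (suc m) → ℕ) →
                 ∑ (allWords k (suc m)) f ≡ ∑[ a ← allFin k ] ∑[ w ← allWords k m ] f (a ∷ᵥ w)
∑-allWords-suc k m f =
  trans (∑-concatMap _ (allFin k) f) (∑-cong (allFin k) (λ a → ∑-map (a ∷ᵥ_) (allWords k m) f))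

∑-allWords-const : (k m x : ℕ) → ∑[ w ← allWords k m ] x ≡ k ^ m * x
∑-allWords-const k zero    x = trans (+-identityʳ x) (sym (+-identityʳ x))
∑-allWords-const k (suc m) x = begin
  ∑[ w ← allWords k (suc m) ] x             ≡⟨ ∑-allWords-suc k m (λ _ → x) ⟩
  ∑[ a ← allFin k ] ∑[ w ← allWords k m ] x ≡⟨ ∑-cong (allFin k) (λ _ → ∑-allWords-const k m x) ⟩
  ∑[ a ← allFin k ] k ^ m * x               ≡⟨ ∑-allFin-const k _ ⟩
  k * (k ^ m * x)                           ≡⟨ *-assoc k (k ^ m) x ⟨
  k ^ suc m * x                             ∎

∑-allWords-suc-split : {k m : ℕ} (f : Vec (Fin k) (suc m) → ℕ) (u : Fin k → ℕ) (v : Vec (Fin k) m → ℕ) →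
                       (∀ a w → f (a ∷ᵥ w) ≡ u a + v w) →
                       ∑ (allWords k (suc m)) f ≡ k ^ m * ∑ (allFin k) u + k * ∑ (allWords k m) v
∑-allWords-suc-split {k} {m} f u v split = begin
  ∑ (allWords k (suc m)) f
    ≡⟨ ∑-allWords-suc k m f ⟩
  ∑[ a ← allFin k ] ∑[ w ← allWords k m ] f (a ∷ᵥ w)
    ≡⟨ ∑-cong (allFin k) (λ a → trans (∑-cong (allWords k m) (split a)) (∑-distrib-+ (allWords k m) _ v)) ⟩
  ∑[ a ← allFin k ] (∑[ w ← allWords k m ] u a) + ∑ (allWords k m) v
    ≡⟨ ∑-distrib-+ (allFin k) _ _ ⟩
  (∑[ a ← allFin k ] ∑[ w ← allWords k m ] u a) + (∑[ a ← allFin k ] ∑ (allWords k m) v)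
    ≡⟨ cong₂ _+_ (trans (∑-cong (allFin k) (λ a → ∑-allWords-const k m (u a)))
                        (sym (*-distribˡ-∑ (k ^ m) (allFin k) u)))
                 (∑-allFin-const k _) ⟩
  k ^ m * ∑ (allFin k) u + k * ∑ (allWords k m) v ∎

-- Indicators and Kronecker deltas

ind-*-cong : ∀ b {x y} → (T b → x ≡ y) → ind b * x ≡ ind b * y
ind-*-cong false eq = refl
ind-*-cong true  eq = cong (_+ 0) (eq _)

ind-∨-disjoint : ∀ p q → (T p → q ≡ false) → ind (p ∨ q) ≡ ind p + ind q
ind-∨-disjoint false q _    = refl
ind-∨-disjoint true  q p⇒¬q = sym (cong (λ b → 1 + ind b) (p⇒¬q _))

ind-not∧-+ : ∀ p q → ind (not p ∧ q) + ind p * ind q ≡ ind q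
ind-not∧-+ false q = +-identityʳ (ind q)
ind-not∧-+ true  q = +-identityʳ (ind q)

does-≟-true : ∀ b → does (b Bool.≟ true) ≡ b
does-≟-true false = refl
does-≟-true true  = refl

≟-sound : {k : ℕ} {a b : Fin k} → T (does (a ≟ b)) → a ≡ b
≟-sound {a = a} {b} with a ≟ b
... | yes a≡b = λ _ → a≡b
... | no  _   = λ ()

δ : {k : ℕ} → Fin k → Fin k → ℕ
δ a b = ind (does (a ≟ b))

δ-sym : {k : ℕ} (a b : Fin k) → δ a b ≡ δ b a
δ-sym a b = cong ind (does-⇔ (mk⇔ sym sym) (a ≟ b) (b ≟ a))

∑-allFin-δ : {k : ℕ} (a : Fin k) (h : Fin k → ℕ) → ∑[ b ← allFin k ] δ a b * h b ≡ h a
∑-allFin-δ {suc k} Fin.zero h = begin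
  ∑[ b ← allFin (suc k) ] δ Fin.zero b * h b
    ≡⟨ ∑-allFin-suc k _ ⟩
  h Fin.zero + 0 + (∑[ b ← allFin k ] 0)
    ≡⟨ cong₂ _+_ (+-identityʳ _) (trans (∑-allFin-const k 0) (*-zeroʳ k)) ⟩
  h Fin.zero + 0
    ≡⟨ +-identityʳ _ ⟩
  h Fin.zero ∎
∑-allFin-δ {suc k} (Fin.suc a) h =
  trans (∑-allFin-suc k (λ b → δ (Fin.suc a) b * h b)) (∑-allFin-δ a (h ∘ Fin.suc))

∑-allFin-involution : {k : ℕ} (f : Fin k → Fin k) → (∀ a → f (f a) ≡ a) →
                      (h : Fin k → ℕ) → ∑[ a ← allFin k ] h (f a) ≡ ∑ (allFin k) h
∑-allFin-involution {k} f f∘f≡id h = begin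
  ∑[ a ← allFin k ] h (f a)
    ≡⟨ ∑-cong (allFin k) (λ a → ∑-allFin-δ (f a) h) ⟨
  ∑[ a ← allFin k ] ∑[ b ← allFin k ] δ (f a) b * h b
    ≡⟨ ∑-comm (allFin k) (allFin k) _ ⟩
  ∑[ b ← allFin k ] ∑[ a ← allFin k ] δ (f a) b * h b
    ≡⟨ ∑-cong (allFin k) (λ b → ∑-cong (allFin k) (λ a → cong (_* h b) (δ-swap a b))) ⟩
  ∑[ b ← allFin k ] ∑[ a ← allFin k ] δ (f b) a * h b
    ≡⟨ ∑-cong (allFin k) (λ b → ∑-allFin-δ (f b) (λ _ → h b)) ⟩
  ∑ (allFin k) h ∎
  where
  δ-swap : ∀ a b → δ (f a) b ≡ δ (f b) a
  δ-swap a b = cong ind (does-⇔ (mk⇔ (λ { refl → f∘f≡id a }) (λ { refl → f∘f≡id b }))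
                                (f a ≟ b) (f b ≟ a))

∑-allWords-involution : {k : ℕ} (f : Fin k → Fin k) → (∀ a → f (f a) ≡ a) →
                        (m : ℕ) (g : Vec (Fin k) m → ℕ) →
                        ∑[ w ← allWords k m ] g (Vec.map f w) ≡ ∑ (allWords k m) g
∑-allWords-involution f f∘f≡id zero    g = refl
∑-allWords-involution {k} f f∘f≡id (suc m) g = begin
  ∑[ w ← allWords k (suc m) ] g (Vec.map f w)
    ≡⟨ ∑-allWords-suc k m _ ⟩
  ∑[ a ← allFin k ] ∑[ w ← allWords k m ] g (f a ∷ᵥ Vec.map f w)
    ≡⟨ ∑-cong (allFin k) (λ a → ∑-allWords-involution f f∘f≡id m (g ∘ (f a ∷ᵥ_))) ⟩
  ∑[ a ← allFin k ] ∑[ w ← allWords k m ] g (f a ∷ᵥ w)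
    ≡⟨ ∑-allFin-involution f f∘f≡id (λ a → ∑[ w ← allWords k m ] g (a ∷ᵥ w)) ⟩
  ∑[ a ← allFin k ] ∑[ w ← allWords k m ] g (a ∷ᵥ w)
    ≡⟨ ∑-allWords-suc k m g ⟨
  ∑ (allWords k (suc m)) g ∎

∑-allFin-∧-nonzero : (d : ℕ) (p : Bool) → ∑[ b ← allFin (suc d) ] ind (p ∧ (0 <ᵇ toℕ b)) ≡ d * ind p
∑-allFin-∧-nonzero d false = trans (∑-allFin-const (suc d) 0) (trans (*-zeroʳ (suc d)) (sym (*-zeroʳ d)))
∑-allFin-∧-nonzero d true  = trans (∑-allFin-suc d (λ b → ind (0 <ᵇ toℕ b))) (∑-allFin-const d 1)

-- Words with distinct letters

-- Defs.distinct tests membership with a where-bound helper that cannot be named from outside;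
-- unification recovers it, and it then unfolds definitionally.
occurs-unfolding : Σ (∀ {k} → Fin k → List (Fin k) → Bool)
                     λ occurs → ∀ {k} (a : Fin k) xs → distinct (a ∷ xs) ≡ not (occurs a xs) ∧ distinct xs
occurs-unfolding = _ , λ _ _ → refl

occurs : {k : ℕ} → Fin k → List (Fin k) → Bool
occurs = proj₁ occurs-unfolding

distinct-∷⁻ : {k : ℕ} (a : Fin k) (xs : List (Fin k)) →
              T (distinct (a ∷ xs)) → occurs a xs ≡ false × T (distinct xs)
distinct-∷⁻ a xs d = let (a∉xs , dxs) = Equivalence.to T-∧ d in Equivalence.to T-not-≡ a∉xs , dxs

occurs-δ : {k : ℕ} (a : Fin k) (xs : List (Fin k)) → T (distinct xs) → ind (occurs a xs) ≡ ∑[ y ← xs ] δ a y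
occurs-δ a []       _ = refl
occurs-δ a (y ∷ ys) d = begin
  ind (does (a ≟ y) ∨ occurs a ys)
    ≡⟨ ind-∨-disjoint _ _ (λ a≡y → subst (λ z → occurs z ys ≡ false) (sym (≟-sound a≡y)) y∉ys) ⟩
  δ a y + ind (occurs a ys)
    ≡⟨ cong (δ a y +_) (occurs-δ a ys dys) ⟩
  δ a y + (∑[ y′ ← ys ] δ a y′) ∎
  where
  y∉ys = proj₁ (distinct-∷⁻ y ys d)
  dys  = proj₂ (distinct-∷⁻ y ys d)

∑-occurs : {k : ℕ} (xs : List (Fin k)) → T (distinct xs) → ∑[ a ← allFin k ] ind (occurs a xs) ≡ length xs
∑-occurs {k} xs d = begin
  ∑[ a ← allFin k ] ind (occurs a xs)     ≡⟨ ∑-cong (allFin k) (λ a → occurs-δ a xs d) ⟩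
  ∑[ a ← allFin k ] ∑[ y ← xs ] δ a y     ≡⟨ ∑-comm (allFin k) xs δ ⟩
  ∑[ y ← xs ] ∑[ a ← allFin k ] δ a y     ≡⟨ ∑-cong xs (λ y → ∑-cong (allFin k) (λ a →
                                               trans (δ-sym a y) (sym (*-identityʳ _)))) ⟩
  ∑[ y ← xs ] ∑[ a ← allFin k ] δ y a * 1 ≡⟨ ∑-cong xs (λ y → ∑-allFin-δ y (λ _ → 1)) ⟩
  ∑[ y ← xs ] 1                           ≡⟨ ∑-const xs 1 ⟩
  length xs * 1                           ≡⟨ *-identityʳ _ ⟩
  length xs                               ∎

occurs-map : {k l : ℕ} (f : Fin k → Fin l) → Injective _≡_ _≡_ f →
             (a : Fin k) (xs : List (Fin k)) → occurs (f a) (map f xs) ≡ occurs a xs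
occurs-map f f-inj a []       = refl
occurs-map f f-inj a (y ∷ ys) =
  cong₂ _∨_ (does-⇔ (mk⇔ f-inj (cong f)) (f a ≟ f y) (a ≟ y)) (occurs-map f f-inj a ys)

distinct-map : {k l : ℕ} (f : Fin k → Fin l) → Injective _≡_ _≡_ f →
               (xs : List (Fin k)) → distinct (map f xs) ≡ distinct xs
distinct-map f f-inj []       = refl
distinct-map f f-inj (x ∷ xs) =
  cong₂ (λ p q → not p ∧ q) (occurs-map f f-inj x xs) (distinct-map f f-inj xs)

𝟙distinct : {k m : ℕ} → Vec (Fin k) m → ℕ
𝟙distinct w = ind (distinct (toList w))

#distinct : ℕ → ℕ → ℕ
#distinct k m = ∑[ w ← allWords k m ] 𝟙distinct w

-- a ∷ w is distinct iff w is and a is one of the k − m letters not occurring in w.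
#distinct-suc : (k m : ℕ) → #distinct k (suc m) + m * #distinct k m ≡ k * #distinct k m
#distinct-suc k m = begin
  #distinct k (suc m) + m * #distinct k m
    ≡⟨ cong₂ _+_ (∑-allWords-suc k m 𝟙distinct) occurrences ⟩
  (∑[ a ← allFin k ] ∑[ w ← W ] ind (not (occurs a (toList w)) ∧ distinct (toList w)))
    + (∑[ a ← allFin k ] ∑[ w ← W ] ind (occurs a (toList w)) * 𝟙distinct w)
    ≡⟨ ∑-distrib-+ (allFin k) _ _ ⟨
  ∑[ a ← allFin k ] (∑[ w ← W ] ind (not (occurs a (toList w)) ∧ distinct (toList w)))
                      + (∑[ w ← W ] ind (occurs a (toList w)) * 𝟙distinct w)
    ≡⟨ ∑-cong (allFin k) (λ a → trans (sym (∑-distrib-+ W _ _))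
                                      (∑-cong W (λ w → ind-not∧-+ (occurs a (toList w)) _))) ⟩
  ∑[ a ← allFin k ] #distinct k m
    ≡⟨ ∑-allFin-const k _ ⟩
  k * #distinct k m ∎
  where
  W = allWords k m
  occurrences : m * #distinct k m ≡ ∑[ a ← allFin k ] ∑[ w ← W ] ind (occurs a (toList w)) * 𝟙distinct w
  occurrences = begin
    m * #distinct k m
      ≡⟨ *-distribˡ-∑ m W 𝟙distinct ⟩
    ∑[ w ← W ] m * 𝟙distinct w
      ≡⟨ ∑-cong W (λ w → trans (*-comm m _) (ind-*-cong (distinct (toList w))
           (λ d → trans (sym (length-toList w)) (sym (∑-occurs (toList w) d))))) ⟩
    ∑[ w ← W ] 𝟙distinct w * (∑[ a ← allFin k ] ind (occurs a (toList w)))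
      ≡⟨ ∑-cong W (λ w → trans (*-comm (𝟙distinct w) _) (*-distribʳ-∑ (𝟙distinct w) (allFin k) _)) ⟩
    ∑[ w ← W ] ∑[ a ← allFin k ] ind (occurs a (toList w)) * 𝟙distinct w
      ≡⟨ ∑-comm W (allFin k) _ ⟩
    ∑[ a ← allFin k ] ∑[ w ← W ] ind (occurs a (toList w)) * 𝟙distinct w ∎

#distinct-falling : ∀ {k} m r → m + r ≡ k → #distinct k m * r ! ≡ k !
#distinct-falling zero    r refl = +-identityʳ (r !)
#distinct-falling {k} (suc m) r m+r≡k = begin
  #distinct k (suc m) * r !   ≡⟨ cong (_* r !) extensions ⟩
  suc r * #distinct k m * r ! ≡⟨ cong (_* r !) (*-comm (suc r) (#distinct k m)) ⟩
  #distinct k m * suc r * r ! ≡⟨ *-assoc (#distinct k m) (suc r) (r !) ⟩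
  #distinct k m * suc r !     ≡⟨ #distinct-falling m (suc r) (trans (+-suc m r) m+r≡k) ⟩
  k !                         ∎
  where
  extensions : #distinct k (suc m) ≡ suc r * #distinct k m
  extensions = +-cancelʳ-≡ (m * #distinct k m) _ _ (begin
    #distinct k (suc m) + m * #distinct k m   ≡⟨ #distinct-suc k m ⟩
    k * #distinct k m                         ≡⟨ cong (_* #distinct k m) (trans (sym m+r≡k) (sym (+-suc m r))) ⟩
    (m + suc r) * #distinct k m               ≡⟨ *-distribʳ-+ (#distinct k m) m (suc r) ⟩
    m * #distinct k m + suc r * #distinct k m ≡⟨ +-comm (m * #distinct k m) _ ⟩
    suc r * #distinct k m + m * #distinct k m ∎)

#distinct-perms : ∀ n → #distinct n n ≡ n !
#distinct-perms n = trans (sym (*-identityʳ (#distinct n n))) (#distinct-falling n 0 (+-identityʳ n))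

-- Inversions and ascents

pairSum-map : (f : B → B → ℕ) (g : A → B) (xs : List A) →
              pairSum f (map g xs) ≡ pairSum (λ a b → f (g a) (g b)) xs
pairSum-map f g []       = refl
pairSum-map f g (x ∷ xs) = cong₂ _+_ (∑-map g xs (f (g x))) (pairSum-map f g xs)

pairSum-cong : {f g : A → A → ℕ} → (∀ a b → f a b ≡ g a b) → (xs : List A) → pairSum f xs ≡ pairSum g xs
pairSum-cong eq []       = refl
pairSum-cong eq (x ∷ xs) = cong₂ _+_ (∑-cong xs (eq x)) (pairSum-cong eq xs)

pairSum-*ˡ : (k : ℕ) (f : A → A → ℕ) (xs : List A) → pairSum (λ x y → k * f x y) xs ≡ k * pairSum f xs
pairSum-*ˡ k f []       = sym (*-zeroʳ k)
pairSum-*ˡ k f (x ∷ xs) =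
  trans (cong₂ _+_ (sym (*-distribˡ-∑ k xs (f x))) (pairSum-*ˡ k f xs)) (sym (*-distribˡ-+ k _ _))

inversions ascents : {k : ℕ} → List (Fin k) → ℕ
inversions = pairSum (λ a b → ind (toℕ b <ᵇ toℕ a))
ascents    = pairSum (λ a b → ind (toℕ a <ᵇ toℕ b))

<ᵇ-connex : ∀ m n → m ≢ n → ind (n <ᵇ m) + ind (m <ᵇ n) ≡ 1
<ᵇ-connex zero    zero    m≢n = ⊥-elim (m≢n refl)
<ᵇ-connex zero    (suc n) _   = refl
<ᵇ-connex (suc m) zero    _   = refl
<ᵇ-connex (suc m) (suc n) m≢n = <ᵇ-connex m n (m≢n ∘ cong suc)

suc-C-2 : ∀ n → suc n C 2 ≡ n + n C 2
suc-C-2 n = trans (sym (nCk+nC[k+1]≡[n+1]C[k+1] n 1)) (cong (_+ n C 2) (nC1≡n n))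

inversions+ascents : {k : ℕ} (xs : List (Fin k)) → T (distinct xs) → inversions xs + ascents xs ≡ length xs C 2
inversions+ascents []       _ = refl
inversions+ascents (x ∷ xs) d = begin
  below + inversions xs + (above + ascents xs)
    ≡⟨ interchange below (inversions xs) above (ascents xs) ⟩
  below + above + (inversions xs + ascents xs)
    ≡⟨ cong₂ _+_ (trans (sym (∑-distrib-+ xs _ _)) (comparable xs x∉xs)) (inversions+ascents xs dxs) ⟩
  length xs + length xs C 2
    ≡⟨ suc-C-2 (length xs) ⟨
  suc (length xs) C 2 ∎
  where
  x∉xs = proj₁ (distinct-∷⁻ x xs d)
  dxs  = proj₂ (distinct-∷⁻ x xs d)
  below above : ℕ
  below = ∑[ y ← xs ] ind (toℕ y <ᵇ toℕ x)
  above = ∑[ y ← xs ] ind (toℕ x <ᵇ toℕ y)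
  true≢false : true ≢ false
  true≢false ()
  comparable : ∀ ys → occurs x ys ≡ false →
               ∑[ y ← ys ] ind (toℕ y <ᵇ toℕ x) + ind (toℕ x <ᵇ toℕ y) ≡ length ys
  comparable []       _    = refl
  comparable (y ∷ ys) x∉ys = cong₂ _+_
    (<ᵇ-connex (toℕ x) (toℕ y) λ x≡y →
      true≢false (trans (sym (dec-true (x ≟ y) (toℕ-injective x≡y))) (∨-conicalˡ _ _ x∉ys)))
    (comparable ys (∨-conicalʳ _ _ x∉ys))

opposite-<ᵇ : {k : ℕ} (a b : Fin k) → (toℕ (opposite b) <ᵇ toℕ (opposite a)) ≡ (toℕ a <ᵇ toℕ b)
opposite-<ᵇ {k} a b rewrite opposite-prop a | opposite-prop b =
  does-⇔ (mk⇔ (s<s⁻¹ ∘ ∸-cancelʳ-< {o = k}) (λ a<b → ∸-monoʳ-< (s<s a<b) (toℕ<n b)))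
         (k ∸ suc (toℕ b) <? k ∸ suc (toℕ a)) (toℕ a <? toℕ b)

opposite-injective : {k : ℕ} → Injective _≡_ _≡_ (opposite {k})
opposite-injective {_} {a} {b} eq =
  trans (sym (opposite-involutive a)) (trans (cong opposite eq) (opposite-involutive b))

inversions-map-opposite : {k : ℕ} (xs : List (Fin k)) → inversions (map opposite xs) ≡ ascents xs
inversions-map-opposite xs =
  trans (pairSum-map _ opposite xs) (pairSum-cong (λ a b → cong ind (opposite-<ᵇ a b)) xs)

∑-inversions≡∑-ascents : (k m : ℕ) →
  ∑[ w ← allWords k m ] 𝟙distinct w * inversions (toList w)
    ≡ ∑[ w ← allWords k m ] 𝟙distinct w * ascents (toList w)
∑-inversions≡∑-ascents k m =
  trans (sym (∑-allWords-involution opposite opposite-involutive m _)) (∑-cong (allWords k m) complement)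
  where
  complement : ∀ w → 𝟙distinct (Vec.map opposite w) * inversions (toList (Vec.map opposite w))
                     ≡ 𝟙distinct w * ascents (toList w)
  complement w rewrite toList-map opposite w =
    cong₂ _*_ (cong ind (distinct-map opposite opposite-injective (toList w))) (inversions-map-opposite (toList w))

∑-inversions+∑-ascents : (k m : ℕ) →
  (∑[ w ← allWords k m ] 𝟙distinct w * inversions (toList w))
    + (∑[ w ← allWords k m ] 𝟙distinct w * ascents (toList w))
    ≡ #distinct k m * (m C 2)
∑-inversions+∑-ascents k m = begin
  (∑[ w ← W ] 𝟙distinct w * inversions (toList w)) + (∑[ w ← W ] 𝟙distinct w * ascents (toList w))
    ≡⟨ ∑-distrib-+ W _ _ ⟨
  ∑[ w ← W ] 𝟙distinct w * inversions (toList w) + 𝟙distinct w * ascents (toList w)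
    ≡⟨ ∑-cong W (λ w → trans (sym (*-distribˡ-+ (𝟙distinct w) _ _)) (ind-*-cong (distinct (toList w))
         (λ d → trans (inversions+ascents (toList w) d) (cong (_C 2) (length-toList w))))) ⟩
  ∑[ w ← W ] 𝟙distinct w * (m C 2)
    ≡⟨ *-distribʳ-∑ (m C 2) W 𝟙distinct ⟨
  #distinct k m * (m C 2) ∎
  where W = allWords k m

∑-perms-linear : (n a b e : ℕ) →
  2 * (∑[ w ← allWords n n ] 𝟙distinct w * (a * inv w + b + e * ascents (toList w)))
    ≡ n ! * ((a + e) * (n C 2) + 2 * b)
∑-perms-linear n a b e = begin
  2 * (∑[ w ← W ] 𝟙distinct w * (a * inv w + b + e * ascents (toList w)))
    ≡⟨ cong (2 *_) (∑-cong W (λ w → distribute (𝟙distinct w) a (inv w) b e (ascents (toList w)))) ⟩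
  2 * (∑[ w ← W ] a * (𝟙distinct w * inv w) + b * 𝟙distinct w + e * (𝟙distinct w * ascents (toList w)))
    ≡⟨ cong (2 *_) (trans (∑-distrib-+ W _ _) (cong (_+ _) (∑-distrib-+ W _ _))) ⟩
  2 * ((∑[ w ← W ] a * (𝟙distinct w * inv w)) + (∑[ w ← W ] b * 𝟙distinct w)
       + (∑[ w ← W ] e * (𝟙distinct w * ascents (toList w))))
    ≡⟨ cong (2 *_) (cong₂ _+_ (cong₂ _+_ (sym (*-distribˡ-∑ a W _)) (sym (*-distribˡ-∑ b W _)))
                              (sym (*-distribˡ-∑ e W _))) ⟩
  2 * (a * Inv + b * #distinct n n + e * Asc)
    ≡⟨ cong (λ t → 2 * (a * Inv + b * #distinct n n + e * t)) (sym Inv≡Asc) ⟩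
  2 * (a * Inv + b * #distinct n n + e * Inv)
    ≡⟨ regroup a b e Inv (#distinct n n) ⟩
  (a + e) * (Inv + Inv) + 2 * b * #distinct n n
    ≡⟨ cong (λ t → (a + e) * (Inv + t) + 2 * b * #distinct n n) Inv≡Asc ⟩
  (a + e) * (Inv + Asc) + 2 * b * #distinct n n
    ≡⟨ cong (λ t → (a + e) * t + 2 * b * #distinct n n) (∑-inversions+∑-ascents n n) ⟩
  (a + e) * (#distinct n n * (n C 2)) + 2 * b * #distinct n n
    ≡⟨ cong (λ t → (a + e) * (t * (n C 2)) + 2 * b * t) (#distinct-perms n) ⟩
  (a + e) * (n ! * (n C 2)) + 2 * b * n !
    ≡⟨ factor (a + e) b (n !) (n C 2) ⟩
  n ! * ((a + e) * (n C 2) + 2 * b) ∎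
  where
  W = allWords n n
  Inv = ∑[ w ← W ] 𝟙distinct w * inv w
  Asc = ∑[ w ← W ] 𝟙distinct w * ascents (toList w)
  Inv≡Asc : Inv ≡ Asc
  Inv≡Asc = ∑-inversions≡∑-ascents n n
  distribute : ∀ χ a i b e s → χ * (a * i + b + e * s) ≡ a * (χ * i) + b * χ + e * (χ * s)
  distribute = solve-∀
  regroup : ∀ a b e i D → 2 * (a * i + b * D + e * i) ≡ (a + e) * (i + i) + 2 * b * D
  regroup = solve-∀
  factor : ∀ f b N C → f * (N * C) + 2 * b * N ≡ N * (f * C + 2 * b)
  factor = solve-∀

-- Summing over colourings

-- The factor k on the left stands in for the k^(m-1) of the natural statement, which needs m ≥ 1.
∑-allWords-zip : {A : Set} {k : ℕ} (G : A → Fin k → ℕ) {m : ℕ} (xs : Vec A m) →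
  k * (∑[ cs ← allWords k m ] ∑[ p ← zip (toList xs) (toList cs) ] G (proj₁ p) (proj₂ p))
    ≡ k ^ m * (∑[ x ← toList xs ] ∑ (allFin k) (G x))
∑-allWords-zip {k = k} G []ᵥ = trans (*-zeroʳ k) (sym (*-zeroʳ 1))
∑-allWords-zip {A} {k} G {suc m} (x ∷ᵥ xs) = begin
  k * ∑ (allWords k (suc m)) (Z (x ∷ᵥ xs))
    ≡⟨ cong (k *_) (∑-allWords-suc-split _ (G x) (Z xs) (λ _ _ → refl)) ⟩
  k * (k ^ m * ∑ (allFin k) (G x) + k * ∑ (allWords k m) (Z xs))
    ≡⟨ cong (λ t → k * (k ^ m * ∑ (allFin k) (G x) + t)) (∑-allWords-zip G xs) ⟩
  k * (k ^ m * ∑ (allFin k) (G x) + k ^ m * (∑[ y ← toList xs ] ∑ (allFin k) (G y)))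
    ≡⟨ cong (k *_) (*-distribˡ-+ (k ^ m) _ _) ⟨
  k * (k ^ m * (∑ (allFin k) (G x) + (∑[ y ← toList xs ] ∑ (allFin k) (G y))))
    ≡⟨ *-assoc k (k ^ m) _ ⟨
  k ^ suc m * (∑ (allFin k) (G x) + (∑[ y ← toList xs ] ∑ (allFin k) (G y))) ∎
  where
  Z : ∀ {j} → Vec A j → Vec (Fin k) j → ℕ
  Z ys cs = ∑[ p ← zip (toList ys) (toList cs) ] G (proj₁ p) (proj₂ p)

∑-allWords-pairSum-zip : {A : Set} {k : ℕ} (G : A → A → Fin k → ℕ) {m : ℕ} (xs : Vec A m) →
  k * (∑[ cs ← allWords k m ] pairSum (λ p q → G (proj₁ p) (proj₁ q) (proj₂ q)) (zip (toList xs) (toList cs)))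
    ≡ k ^ m * pairSum (λ x y → ∑ (allFin k) (G x y)) (toList xs)
∑-allWords-pairSum-zip {k = k} G []ᵥ = trans (*-zeroʳ k) (sym (*-zeroʳ 1))
∑-allWords-pairSum-zip {A} {k} G {suc m} (x ∷ᵥ xs) = begin
  k * ∑ (allWords k (suc m)) (P (x ∷ᵥ xs))
    ≡⟨ cong (k *_) (trans (∑-allWords-suc k m (P (x ∷ᵥ xs))) (∑-allFin-const k _)) ⟩
  k * (k * (∑[ cs ← allWords k m ] Z cs + P xs cs))
    ≡⟨ cong (k *_) (trans (cong (k *_) (∑-distrib-+ (allWords k m) Z (P xs))) (*-distribˡ-+ k _ _)) ⟩
  k * (k * ∑ (allWords k m) Z + k * ∑ (allWords k m) (P xs))
    ≡⟨ cong (k *_) (cong₂ _+_ (∑-allWords-zip (G x) xs) (∑-allWords-pairSum-zip G xs)) ⟩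
  k * (k ^ m * (∑[ y ← toList xs ] ∑ (allFin k) (G x y)) + k ^ m * pairSum Gsum (toList xs))
    ≡⟨ cong (k *_) (*-distribˡ-+ (k ^ m) _ _) ⟨
  k * (k ^ m * pairSum Gsum (x ∷ toList xs))
    ≡⟨ *-assoc k (k ^ m) _ ⟨
  k ^ suc m * pairSum Gsum (x ∷ toList xs) ∎
  where
  P : ∀ {j} → Vec A j → Vec (Fin k) j → ℕ
  P ys cs = pairSum (λ p q → G (proj₁ p) (proj₁ q) (proj₂ q)) (zip (toList ys) (toList cs))
  Z : Vec (Fin k) m → ℕ
  Z cs = ∑[ q ← zip (toList xs) (toList cs) ] G x (proj₁ q) (proj₂ q)
  Gsum : A → A → ℕ
  Gsum y z = ∑ (allFin k) (G y z)

∑-colourings-col : {c n : ℕ} (w : Vec (Fin n) n) →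
  c * (∑[ cs ← allWords c n ] col (w , cs)) ≡ c ^ n * (n * ∑ (allFin c) toℕ)
∑-colourings-col {c} {n} w = begin
  c * (∑[ cs ← allWords c n ] col (w , cs))
    ≡⟨ cong (c *_) (∑-cong (allWords c n) (λ cs → sym (∑-zip-proj₂ w cs toℕ))) ⟩
  c * (∑[ cs ← allWords c n ] ∑[ p ← zip (toList w) (toList cs) ] toℕ (proj₂ p))
    ≡⟨ ∑-allWords-zip (λ _ b → toℕ b) w ⟩
  c ^ n * (∑[ x ← toList w ] ∑ (allFin c) toℕ)
    ≡⟨ cong (c ^ n *_) (trans (∑-const (toList w) _) (cong (_* ∑ (allFin c) toℕ) (length-toList w))) ⟩
  c ^ n * (n * ∑ (allFin c) toℕ) ∎

∑-colourings-ascNZ : (d : ℕ) {n : ℕ} (w : Vec (Fin n) n) →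
  suc d * (∑[ cs ← allWords (suc d) n ] ascNZ (w , cs)) ≡ suc d ^ n * (d * ascents (toList w))
∑-colourings-ascNZ d {n} w = begin
  suc d * (∑[ cs ← allWords (suc d) n ] ascNZ (w , cs))
    ≡⟨ ∑-allWords-pairSum-zip (λ x y b → ind ((toℕ x <ᵇ toℕ y) ∧ (0 <ᵇ toℕ b))) w ⟩
  suc d ^ n * pairSum (λ x y → ∑[ b ← allFin (suc d) ] ind ((toℕ x <ᵇ toℕ y) ∧ (0 <ᵇ toℕ b))) (toList w)
    ≡⟨ cong (suc d ^ n *_) (pairSum-cong (λ x y → ∑-allFin-∧-nonzero d (toℕ x <ᵇ toℕ y)) (toList w)) ⟩
  suc d ^ n * pairSum (λ x y → d * ind (toℕ x <ᵇ toℕ y)) (toList w)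
    ≡⟨ cong (suc d ^ n *_) (pairSum-*ˡ d _ (toList w)) ⟩
  suc d ^ n * (d * ascents (toList w)) ∎

∑-colourings-invc : (d : ℕ) {n : ℕ} (w : Vec (Fin n) n) →
  suc d * (∑[ cs ← allWords (suc d) n ] invc (suc d) (w , cs))
    ≡ suc d ^ n * (suc d * inv w + n * ∑ (allFin (suc d)) toℕ + suc d * d * ascents (toList w))
∑-colourings-invc d {n} w = begin
  c * (∑[ cs ← allWords c n ] invc c (w , cs))
    ≡⟨ cong (c *_) (∑-distrib-+ (allWords c n) _ _) ⟩
  c * ((∑[ cs ← allWords c n ] inv w + col (w , cs)) + (∑[ cs ← allWords c n ] c * ascNZ (w , cs)))
    ≡⟨ cong₂ (λ s t → c * (s + t))
             (trans (∑-distrib-+ (allWords c n) _ _) (cong (_+ Col) (∑-allWords-const c n (inv w))))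
             (sym (*-distribˡ-∑ c (allWords c n) _)) ⟩
  c * (c ^ n * inv w + Col + c * Asc)
    ≡⟨ distribute c (c ^ n) (inv w) Col Asc ⟩
  c ^ n * (c * inv w) + c * Col + c * (c * Asc)
    ≡⟨ cong₂ (λ s t → c ^ n * (c * inv w) + s + c * t) (∑-colourings-col w) (∑-colourings-ascNZ d w) ⟩
  c ^ n * (c * inv w) + c ^ n * (n * ∑ (allFin c) toℕ) + c * (c ^ n * (d * ascents (toList w)))
    ≡⟨ collect c (c ^ n) (inv w) (n * ∑ (allFin c) toℕ) d (ascents (toList w)) ⟩
  c ^ n * (c * inv w + n * ∑ (allFin c) toℕ + c * d * ascents (toList w)) ∎
  where
  c = suc d
  Col = ∑[ cs ← allWords c n ] col (w , cs)
  Asc = ∑[ cs ← allWords c n ] ascNZ (w , cs)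
  distribute : ∀ c P i s a → c * (P * i + s + c * a) ≡ P * (c * i) + c * s + c * (c * a)
  distribute = solve-∀
  collect : ∀ c P i s d a → P * (c * i) + P * s + c * (P * (d * a)) ≡ P * (c * i + s + c * d * a)
  collect = solve-∀

I-as-∑ : (c n : ℕ) → I c n ≡ ∑[ w ← allWords n n ] 𝟙distinct w * (∑[ cs ← allWords c n ] invc c (w , cs))
I-as-∑ c n = begin
  I c n
    ≡⟨ ∑-concatMap _ (perms n) (invc c) ⟩
  ∑[ p ← perms n ] ∑ (map (p ,_) (allWords c n)) (invc c)
    ≡⟨ ∑-cong (perms n) (λ p → ∑-map (p ,_) (allWords c n) (invc c)) ⟩
  ∑[ p ← perms n ] ∑[ cs ← allWords c n ] invc c (p , cs)
    ≡⟨ ∑-filter (λ w → distinct (toList w) Bool.≟ true) (allWords n n) _ ⟩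
  ∑[ w ← allWords n n ] ind (does (distinct (toList w) Bool.≟ true)) * Σinvc w
    ≡⟨ ∑-cong (allWords n n) (λ w → cong (λ b → ind b * Σinvc w) (does-≟-true (distinct (toList w)))) ⟩
  ∑[ w ← allWords n n ] 𝟙distinct w * Σinvc w ∎
  where
  Σinvc : Vec (Fin n) n → ℕ
  Σinvc w = ∑[ cs ← allWords c n ] invc c (w , cs)

*-I-as-∑-perms : (d n : ℕ) →
  suc d * I (suc d) n
    ≡ suc d ^ n * (∑[ w ← allWords n n ] 𝟙distinct w
                     * (suc d * inv w + n * ∑ (allFin (suc d)) toℕ + suc d * d * ascents (toList w)))
*-I-as-∑-perms d n =
  trans (cong (suc d *_) (I-as-∑ (suc d) n)) (*-∑-cong (suc d) (suc d ^ n) (allWords n n) λ w →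
    trans (*-left-comm (suc d) (𝟙distinct w) _)
          (trans (cong (𝟙distinct w *_) (∑-colourings-invc d w)) (*-left-comm (𝟙distinct w) (suc d ^ n) _)))

suc-*-C-2-∸ : (d n : ℕ) → suc d * (suc n C 2) ∸ n ≡ suc d * (n C 2) + d * n
suc-*-C-2-∸ d n = begin
  suc d * (suc n C 2) ∸ n           ≡⟨ cong (λ t → suc d * t ∸ n) (suc-C-2 n) ⟩
  suc d * (n + n C 2) ∸ n           ≡⟨ cong (_∸ n) (split d n (n C 2)) ⟩
  n + (suc d * (n C 2) + d * n) ∸ n ≡⟨ m+n∸m≡n n _ ⟩
  suc d * (n C 2) + d * n           ∎
  where
  split : ∀ d n C → suc d * (n + C) ≡ n + (suc d * C + d * n)
  split = solve-∀

theorem3p8 : (c n : ℕ) → 1 ≤ c →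
    2 * I c n ≡ (c ^ n) * (n !) * (c * (suc n C 2) ∸ n)
theorem3p8 (suc d) n _ = *-cancelˡ-≡ _ _ (suc d) (begin
  c * (2 * I c n)
    ≡⟨ *-left-comm c 2 (I c n) ⟩
  2 * (c * I c n)
    ≡⟨ cong (2 *_) (*-I-as-∑-perms d n) ⟩
  2 * (c ^ n * S)
    ≡⟨ *-left-comm 2 (c ^ n) S ⟩
  c ^ n * (2 * S)
    ≡⟨ cong (c ^ n *_) (∑-perms-linear n c (n * Σb) (c * d)) ⟩
  c ^ n * (n ! * ((c + c * d) * (n C 2) + 2 * (n * Σb)))
    ≡⟨ cong (λ t → c ^ n * (n ! * ((c + c * d) * (n C 2) + t))) colour-total ⟩
  c ^ n * (n ! * ((c + c * d) * (n C 2) + n * (c * d)))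
    ≡⟨ regroup d n (n !) (n C 2) (c ^ n) ⟩
  c * (c ^ n * n ! * (c * (n C 2) + d * n))
    ≡⟨ cong (λ t → c * (c ^ n * n ! * t)) (suc-*-C-2-∸ d n) ⟨
  c * (c ^ n * n ! * (c * (suc n C 2) ∸ n)) ∎)
  where
  c = suc d
  Σb = ∑ (allFin c) toℕ
  S = ∑[ w ← allWords n n ] 𝟙distinct w * (c * inv w + n * Σb + c * d * ascents (toList w))
  colour-total : 2 * (n * Σb) ≡ n * (c * d)
  colour-total = trans (*-left-comm 2 n Σb) (cong (n *_) (2*∑-allFin-toℕ d))
  regroup : ∀ d n F C P →
            P * (F * ((suc d + suc d * d) * C + n * (suc d * d))) ≡ suc d * (P * F * (suc d * C + d * n))
  regroup = solve-∀
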